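{- Let $A$ be a real symmetric matrix of tropical rank two. Then the symmetric tropical rank of $A$ is greater than two if and only if some principal $3 \times 3$ submatrix of $A$ is not symmetrically tropically singular.
   Context: For a real matrix, a square submatrix with row index set $I$ and column index set $J$ is tropically singular if the minimum of $\sum_{i\in I} A_{i,\rho(i)}$ over bijections $\rho: I \to J$ is attained by at least two bijections; the (standard) tropical rank is the largest $s$ such that there is an $s\times s$ submatrix that is not tropically singular. For a symmetric real matrix, a square submatrix is symmetrically tropically singular if, associating to each bijection $\rho$ the monomial $\prod_{i \in I} X_{\{i,\rho(i)\}}$ in commuting variables indexed by unordered pairs (so $X_{i,j}=X_{j,i}$) with value $\sum_{i\in I} A_{i,\rho(i)}$, the minimum value is attained by at least two distinct monomials; the symmetric tropical rank is the largest $s$ such that some $s\times s$ submatrix is not symmetrically tropically singular. A principal submatrix is one whose row and column index sets coincide. -}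

module Defs where

open import Level using (0ℓ)
open import Data.Nat using (ℕ; zero; suc; _>_)
open import Data.Fin using (Fin; zero; suc)
open import Data.Fin.Permutation using (Permutation′; _⟨$⟩ʳ_)
open import Data.Product using (Σ; ∃; ∃-syntax; _×_; _,_)
open import Data.Sum using (_⊎_)
open import Data.Empty using (⊥)
open import Relation.Nullary using (¬_)
open import Relation.Unary using (Pred)
open import Relation.Binary.PropositionalEquality using (_≡_; _≢_)
open import Relation.Binary.Structures using (IsTotalOrder)
open import Algebra.Structures using (IsCommutativeRing)
open import Function.Definitions using (Injective)
open import Data.Bool using (Bool; true; false; _∧_; _∨_)
open import Data.Fin using (_≟_)
open import Relation.Nullary.Decidable using (⌊_⌋)

countℕ : ∀ {s} → (Fin s → Bool) → ℕ
countℕ {zero}  f = zero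
countℕ {suc s} f with f zero
... | true  = suc (countℕ (λ i → f (suc i)))
... | false = countℕ (λ i → f (suc i))

-- An axiomatic model of the real numbers: a Dedekind-complete ordered
-- field (agda-stdlib has no reals).  Any two models are isomorphic, so
-- quantifying over all models is the same as speaking about ℝ.

record RealNumbers : Set₁ where
  infixl 6 _+_
  infixl 7 _*_
  infix 4 _≤_
  field
    ℝ     : Set
    _+_   : ℝ → ℝ → ℝ
    _*_   : ℝ → ℝ → ℝ
    -_    : ℝ → ℝ
    0ℝ 1ℝ : ℝ
    _≤_   : ℝ → ℝ → Set
    isCommutativeRing : IsCommutativeRing _≡_ _+_ _*_ -_ 0ℝ 1ℝ
    0≢1   : 0ℝ ≢ 1ℝ
    inverse : ∀ x → x ≢ 0ℝ → ∃[ y ] (x * y ≡ 1ℝ)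
    isTotalOrder : IsTotalOrder _≡_ _≤_
    +-mono-≤ : ∀ {x y} z → x ≤ y → x + z ≤ y + z
    *-nonneg : ∀ {x y} → 0ℝ ≤ x → 0ℝ ≤ y → 0ℝ ≤ x * y
    complete : (P : Pred ℝ 0ℓ) → (∃[ x ] P x) → (∃[ b ] (∀ x → P x → x ≤ b)) →
               ∃[ s ] ((∀ x → P x → x ≤ s) × (∀ b → (∀ x → P x → x ≤ b) → s ≤ b))

module Tropical (R : RealNumbers) where
  open RealNumbers R

  Σℝ : ∀ {s} → (Fin s → ℝ) → ℝ
  Σℝ {zero}  f = 0ℝ
  Σℝ {suc s} f = f zero + Σℝ (λ i → f (suc i))

  Matrix : ℕ → Set
  Matrix n = Fin n → Fin n → ℝ

  Symmetric : ∀ {n} → Matrix n → Set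
  Symmetric A = ∀ i j → A i j ≡ A j i

  -- An s-element index set I ⊆ {0..n-1} is given by an injective
  -- enumeration r : Fin s → Fin n.  A bijection ρ : I → J (I, J
  -- enumerated by r, c) is ρ (r k) = c (σ k) for a permutation σ of Fin s.
  IndexSet : ℕ → ℕ → Set
  IndexSet s n = Σ (Fin s → Fin n) Injective′
    where Injective′ = λ (f : Fin s → Fin n) → Injective _≡_ _≡_ f

  module _ {n s : ℕ} (A : Matrix n) (I J : IndexSet s n) where
    private
      r = Data.Product.proj₁ I
      c = Data.Product.proj₁ J

    value : Permutation′ s → ℝ
    value σ = Σℝ (λ k → A (r k) (c (σ ⟨$⟩ʳ k)))

    Minimizer : Permutation′ s → Set
    Minimizer σ = ∀ τ → value σ ≤ value τ

    DistinctBij : Permutation′ s → Permutation′ s → Set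
    DistinctBij σ τ = ∃[ k ] (σ ⟨$⟩ʳ k ≢ τ ⟨$⟩ʳ k)

    TropicallySingular : Set
    TropicallySingular =
      ∃[ σ ] ∃[ τ ] (Minimizer σ × Minimizer τ × DistinctBij σ τ)

    -- does the k-th factor X_{r k, c(σ k)} equal X_{p,q}?  (X_{i,j} = X_{j,i})
    isFactor : Permutation′ s → Fin s → Fin n → Fin n → Bool
    isFactor σ k p q =
      (⌊ r k ≟ p ⌋ ∧ ⌊ c (σ ⟨$⟩ʳ k) ≟ q ⌋) ∨ (⌊ r k ≟ q ⌋ ∧ ⌊ c (σ ⟨$⟩ʳ k) ≟ p ⌋)

    -- exponent of X_{p,q} in the monomial ∏_k X_{r k, c(σ k)}
    exponent : Permutation′ s → Fin n → Fin n → ℕ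
    exponent σ p q = countℕ (λ k → isFactor σ k p q)

    DistinctMonomial : Permutation′ s → Permutation′ s → Set
    DistinctMonomial σ τ = ∃[ p ] ∃[ q ] (exponent σ p q ≢ exponent τ p q)

    SymTropicallySingular : Set
    SymTropicallySingular =
      ∃[ σ ] ∃[ τ ] (Minimizer σ × Minimizer τ × DistinctMonomial σ τ)

  TropicalRankIs : ∀ {n} → Matrix n → ℕ → Set
  TropicalRankIs {n} A t =
    (∃[ I ] ∃[ J ] ¬ TropicallySingular {n} {t} A I J) ×
    (∀ s → s > t → ∀ (I J : IndexSet s n) → TropicallySingular A I J)

  SymTropicalRank> : ∀ {n} → Matrix n → ℕ → Set
  SymTropicalRank> {n} A t =
    ∃[ s ] (s > t × ∃[ I ] ∃[ J ] ¬ SymTropicallySingular {n} {s} A I J)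

{-# OPTIONS --safe #-}
-- Reduce a symmetrically non-singular s × s submatrix, s ≥ 3, to a 3 × 3 one:
-- since the tropical rank is 2 it has a minimizing bijection, and deleting a
-- row together with the column it is matched to keeps it symmetrically
-- non-singular.  A 3 × 3 submatrix with row set I and column set J that is
-- tropically singular but not symmetrically so has two distinct minimizing
-- bijections with the same monomial.  Where they differ, each factor
-- X_{i,j} of one must occur in the other as X_{j,i}, which exhibits three
-- rows of I as columns of J; hence I = J and the submatrix is principal up
-- to reordering its columns.
module Submission where

open import Defs
open import Level using (0ℓ)
open import Algebra.Structures using (IsCommutativeRing)
open import Data.Bool using (Bool; true; false; T; _∧_; _∨_)
open import Data.Bool.Properties using (T-∧; T-∨; T-≡)
open import Data.Fin using (Fin; zero; suc; punchIn; punchOut; _≟_)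
open import Data.Fin.Patterns using (0F; 1F; 2F)
open import Data.Fin.Permutation
  using (Permutation′; _⟨$⟩ʳ_; permutation; _∘ₚ_; flip; inverseʳ;
         insert; remove; insert-punchIn; insert-remove)
open import Data.Fin.Properties
  using (any?; injective⇒≤; suc-injective; punchIn-injective; punchOut-injective)
open import Data.Nat using (ℕ; zero; suc; s≤s; z≤n)
import Data.Nat as ℕ
import Data.Nat.Properties as ℕₚ
open import Data.Product using (∃-syntax; _×_; _,_; proj₁; proj₂)
import Data.Product as Product
open import Data.Sum using (_⊎_; inj₁; inj₂)
import Data.Sum as Sum
open import Function.Base using (_∘_; id)
open import Function.Bundles using (_⇔_; mk⇔; Equivalence)
open import Function.Definitions using (Injective)
open import Relation.Binary.Bundles using (Preorder)
open import Relation.Binary.PropositionalEquality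
  using (_≡_; _≢_; refl; sym; trans; cong; cong₂; subst)
import Relation.Binary.Reasoning.Preorder as PreorderReasoning
open import Relation.Binary.Structures using (IsTotalOrder)
open import Relation.Nullary using (¬_; Dec; yes; no; contradiction)
open import Relation.Nullary.Decidable using (⌊_⌋; toWitness; fromWitness)

injective⇒surjective : ∀ {n} {f : Fin n → Fin n} → Injective _≡_ _≡_ f →
                       ∀ m → ∃[ i ] (f i ≡ m)
injective⇒surjective {suc n} {f} f-injective m with any? (λ i → f i ≟ m)
... | yes hit = hit
... | no miss = contradiction (injective⇒≤ missed-injective) ℕₚ.1+n≰n
  where
  missed : Fin (suc n) → Fin n
  missed i = punchOut {i = m} {j = f i} (λ m≡fi → miss (i , sym m≡fi))

  missed-injective : Injective _≡_ _≡_ missed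
  missed-injective eq = f-injective (punchOut-injective {i = m} _ _ eq)

injective⇒permutation : ∀ {n} {f : Fin n → Fin n} → Injective _≡_ _≡_ f →
                        ∃[ π ] (∀ i → π ⟨$⟩ʳ i ≡ f i)
injective⇒permutation {f = f} f-injective =
  permutation f f⁻¹ (proj₂ ∘ surjective) (λ i → f-injective (proj₂ (surjective (f i)))) ,
  λ _ → refl
  where
  surjective = injective⇒surjective f-injective
  f⁻¹ = proj₁ ∘ surjective

Fin3-cover : ∀ {p} {P : Fin 3 → Set p} {a b c : Fin 3} →
             a ≢ b → a ≢ c → b ≢ c → P a → P b → P c → ∀ m → P m
Fin3-cover {P = P} {a} {b} {c} a≢b a≢c b≢c Pa Pb Pc m =
  reach (injective⇒surjective triple-injective m)
  where
  triple : Fin 3 → Fin 3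
  triple 0F = a
  triple 1F = b
  triple 2F = c

  triple-injective : Injective _≡_ _≡_ triple
  triple-injective {0F} {0F} _  = refl
  triple-injective {0F} {1F} eq = contradiction eq a≢b
  triple-injective {0F} {2F} eq = contradiction eq a≢c
  triple-injective {1F} {0F} eq = contradiction (sym eq) a≢b
  triple-injective {1F} {1F} _  = refl
  triple-injective {1F} {2F} eq = contradiction eq b≢c
  triple-injective {2F} {0F} eq = contradiction (sym eq) a≢c
  triple-injective {2F} {1F} eq = contradiction (sym eq) b≢c
  triple-injective {2F} {2F} _  = refl

  reach : ∃[ t ] (triple t ≡ m) → P m
  reach (0F , eq) = subst P eq Pa
  reach (1F , eq) = subst P eq Pb
  reach (2F , eq) = subst P eq Pc

countℕ-cong : ∀ {s} {f g : Fin s → Bool} → (∀ i → f i ≡ g i) → countℕ f ≡ countℕ g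
countℕ-cong {zero} _ = refl
countℕ-cong {suc s} {f} {g} f≗g with f zero | g zero | f≗g zero
... | true  | .true  | refl = cong suc (countℕ-cong (f≗g ∘ suc))
... | false | .false | refl = countℕ-cong (f≗g ∘ suc)

countℕ-tail-cancel : ∀ {s} (f g : Fin (suc s) → Bool) → f zero ≡ g zero →
                     countℕ f ≡ countℕ g → countℕ (f ∘ suc) ≡ countℕ (g ∘ suc)
countℕ-tail-cancel f g head eq with f zero | g zero | head
... | true  | .true  | refl = ℕₚ.suc-injective eq
... | false | .false | refl = eq

T⇒countℕ≢0 : ∀ {s} (f : Fin s → Bool) k → T (f k) → countℕ f ≢ 0
T⇒countℕ≢0 f zero t with f zero
... | true = λ ()
T⇒countℕ≢0 f (suc k) t with f zero
... | true  = λ ()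
... | false = T⇒countℕ≢0 (f ∘ suc) k t

countℕ≢0⇒T : ∀ {s} (f : Fin s → Bool) → countℕ f ≢ 0 → ∃[ k ] T (f k)
countℕ≢0⇒T {zero}  f c = contradiction refl c
countℕ≢0⇒T {suc s} f c with f zero in eq
... | true  = zero , Equivalence.from T-≡ eq
... | false = Product.map suc id (countℕ≢0⇒T (f ∘ suc) c)

-- `isFactor A I J σ k` unfolds to `samePair (r k) (c (σ ⟨$⟩ʳ k))`.
samePair : ∀ {n} → Fin n → Fin n → Fin n → Fin n → Bool
samePair a b p q = (⌊ a ≟ p ⌋ ∧ ⌊ b ≟ q ⌋) ∨ (⌊ a ≟ q ⌋ ∧ ⌊ b ≟ p ⌋)

T-∧-decided : ∀ {x y} {X : Set x} {Y : Set y} (x? : Dec X) (y? : Dec Y) →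
              T (⌊ x? ⌋ ∧ ⌊ y? ⌋) ⇔ (X × Y)
T-∧-decided x? y? = mk⇔
  (Product.map toWitness toWitness ∘ Equivalence.to (T-∧ {⌊ x? ⌋}))
  (Equivalence.from (T-∧ {⌊ x? ⌋}) ∘ Product.map fromWitness fromWitness)

samePair-refl : ∀ {n} (a b : Fin n) → T (samePair a b a b)
samePair-refl a b = Equivalence.from (T-∨ {⌊ a ≟ a ⌋ ∧ ⌊ b ≟ b ⌋})
  (inj₁ (Equivalence.from (T-∧-decided (a ≟ a) (b ≟ b)) (refl , refl)))

samePair-sound : ∀ {n} {a b p q : Fin n} → T (samePair a b p q) →
                 (a ≡ p × b ≡ q) ⊎ (a ≡ q × b ≡ p)
samePair-sound {a = a} {b} {p} {q} =
  Sum.map (Equivalence.to (T-∧-decided (a ≟ p) (b ≟ q)))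
          (Equivalence.to (T-∧-decided (a ≟ q) (b ≟ p)))
  ∘ Equivalence.to (T-∨ {⌊ a ≟ p ⌋ ∧ ⌊ b ≟ q ⌋})

module Submatrices (R : RealNumbers) where
  open RealNumbers R
  open Tropical R
  open IsCommutativeRing isCommutativeRing using (+-comm)

  ≤-preorder : Preorder 0ℓ 0ℓ 0ℓ
  ≤-preorder = record
    { Carrier = ℝ ; _≈_ = _≡_ ; _≲_ = _≤_
    ; isPreorder = IsTotalOrder.isPreorder isTotalOrder }

  open PreorderReasoning ≤-preorder

  +-monoʳ-≤ : ∀ a {x y} → x ≤ y → a + x ≤ a + y
  +-monoʳ-≤ a {x} {y} x≤y = begin
    a + x  ≡⟨ +-comm a x ⟩
    x + a  ≲⟨ +-mono-≤ a x≤y ⟩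
    y + a  ≡⟨ +-comm y a ⟩
    a + y  ∎

  Σℝ-cong : ∀ {s} {f g : Fin s → ℝ} → (∀ i → f i ≡ g i) → Σℝ f ≡ Σℝ g
  Σℝ-cong {zero}  _   = refl
  Σℝ-cong {suc s} f≗g = cong₂ _+_ (f≗g zero) (Σℝ-cong (f≗g ∘ suc))

  module _ {n} (A : Matrix n) where

    SameMonomial : ∀ {s} (I J : IndexSet s n) → Permutation′ s → Permutation′ s → Set
    SameMonomial I J σ τ = ∀ p q → exponent A I J σ p q ≡ exponent A I J τ p q

    nonSymSingular⇒sameMonomial : ∀ {s} {I J : IndexSet s n} {σ τ} →
      ¬ SymTropicallySingular A I J → Minimizer A I J σ → Minimizer A I J τ →
      SameMonomial I J σ τ
    nonSymSingular⇒sameMonomial {I = I} {J} {σ} {τ} nonsingular σ-min τ-min p q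
      with exponent A I J σ p q ℕ.≟ exponent A I J τ p q
    ... | yes same = same
    ... | no differ = contradiction (σ , τ , σ-min , τ-min , p , q , differ) nonsingular

    value-cong : ∀ {s} (I J J′ : IndexSet s n) (σ σ′ : Permutation′ s) →
      (∀ k → proj₁ J (σ ⟨$⟩ʳ k) ≡ proj₁ J′ (σ′ ⟨$⟩ʳ k)) →
      value A I J σ ≡ value A I J′ σ′
    value-cong (r , _) _ _ _ _ same = Σℝ-cong (λ k → cong (A (r k)) (same k))

    exponent-cong : ∀ {s} (I J J′ : IndexSet s n) (σ σ′ : Permutation′ s) →
      (∀ k → proj₁ J (σ ⟨$⟩ʳ k) ≡ proj₁ J′ (σ′ ⟨$⟩ʳ k)) →
      ∀ p q → exponent A I J σ p q ≡ exponent A I J′ σ′ p q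
    exponent-cong (r , _) _ _ _ _ same p q =
      countℕ-cong (λ k → cong (λ b → samePair (r k) b p q) (same k))

    symSingular-transfer : ∀ {s t} (I J : IndexSet s n) (I′ J′ : IndexSet t n)
      (F : Permutation′ s → Permutation′ t) →
      (∀ π → Minimizer A I J π → Minimizer A I′ J′ (F π)) →
      (∀ π ρ p q → exponent A I′ J′ (F π) p q ≡ exponent A I′ J′ (F ρ) p q →
                   exponent A I J π p q ≡ exponent A I J ρ p q) →
      SymTropicallySingular A I J → SymTropicallySingular A I′ J′
    symSingular-transfer _ _ _ _ F F-min F-monomial (π , ρ , π-min , ρ-min , p , q , differ) =
      F π , F ρ , F-min π π-min , F-min ρ ρ-min , p , q , differ ∘ F-monomial π ρ p q

    -- A factor X_{r k, c (τ k)} of τ must occur in σ, and it cannot occur in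
    -- row k, so it occurs reversed.
    sameMonomial⇒reversedFactor : ∀ {s} (I J : IndexSet s n) (σ τ : Permutation′ s) →
      SameMonomial I J σ τ → ∀ k → σ ⟨$⟩ʳ k ≢ τ ⟨$⟩ʳ k →
      ∃[ l ] (proj₁ I l ≡ proj₁ J (τ ⟨$⟩ʳ k) × proj₁ J (σ ⟨$⟩ʳ l) ≡ proj₁ I k)
    sameMonomial⇒reversedFactor (r , r-inj) (c , c-inj) σ τ same k σk≢τk =
      reversed (samePair-sound (proj₂ factorInσ))
      where
      p = r k
      q = c (τ ⟨$⟩ʳ k)

      factorInσ : ∃[ l ] T (samePair (r l) (c (σ ⟨$⟩ʳ l)) p q)
      factorInσ = countℕ≢0⇒T _ λ σ-exponent≡0 →
        T⇒countℕ≢0 _ k (samePair-refl p q) (trans (sym (same p q)) σ-exponent≡0)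

      l = proj₁ factorInσ

      reversed : (r l ≡ p × c (σ ⟨$⟩ʳ l) ≡ q) ⊎ (r l ≡ q × c (σ ⟨$⟩ʳ l) ≡ p) →
                 ∃[ l ] (r l ≡ q × c (σ ⟨$⟩ʳ l) ≡ p)
      reversed (inj₁ (rl≡p , cσl≡q)) = contradiction
        (c-inj (trans (cong (c ∘ (σ ⟨$⟩ʳ_)) (sym (r-inj rl≡p))) cσl≡q)) σk≢τk
      reversed (inj₂ factor) = l , factor

    singular3⇒rows⊆columns : (I J : IndexSet 3 n) →
      TropicallySingular A I J → ¬ SymTropicallySingular A I J →
      ∀ m → ∃[ j ] (proj₁ J j ≡ proj₁ I m)
    singular3⇒rows⊆columns I@(r , r-inj) J@(c , c-inj)
                           (σ , τ , σ-min , τ-min , k , σk≢τk) nonsingular =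
      Fin3-cover k≢l₁ k≢l₂ l₁≢l₂ (_ , cσl₁≡rk) (_ , sym rl₁≡cτk) (_ , sym rl₂≡cσk)
      where
      same : SameMonomial I J σ τ
      same = nonSymSingular⇒sameMonomial {I = I} {J} {σ} {τ} nonsingular σ-min τ-min
      reversed₁ = sameMonomial⇒reversedFactor I J σ τ same k σk≢τk
      reversed₂ = sameMonomial⇒reversedFactor I J τ σ (λ p q → sym (same p q)) k (σk≢τk ∘ sym)
      l₁ = proj₁ reversed₁
      l₂ = proj₁ reversed₂
      rl₁≡cτk = proj₁ (proj₂ reversed₁)
      cσl₁≡rk = proj₂ (proj₂ reversed₁)
      rl₂≡cσk = proj₁ (proj₂ reversed₂)
      cτl₂≡rk = proj₂ (proj₂ reversed₂)

      k≢l₁ : k ≢ l₁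
      k≢l₁ k≡l₁ = σk≢τk (c-inj
        (trans (cong (c ∘ (σ ⟨$⟩ʳ_)) k≡l₁) (trans cσl₁≡rk (trans (cong r k≡l₁) rl₁≡cτk))))

      k≢l₂ : k ≢ l₂
      k≢l₂ k≡l₂ = σk≢τk (sym (c-inj
        (trans (cong (c ∘ (τ ⟨$⟩ʳ_)) k≡l₂) (trans cτl₂≡rk (trans (cong r k≡l₂) rl₂≡cσk)))))

      l₁≢l₂ : l₁ ≢ l₂
      l₁≢l₂ l₁≡l₂ = σk≢τk (c-inj
        (trans (sym rl₂≡cσk) (trans (cong r (sym l₁≡l₂)) rl₁≡cτk)))

    rows⊆columns⇒alignment : ∀ {s} (I J : IndexSet s n) →
      (∀ m → ∃[ j ] (proj₁ J j ≡ proj₁ I m)) →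
      ∃[ Φ ] (∀ m → proj₁ J (Φ ⟨$⟩ʳ m) ≡ proj₁ I m)
    rows⊆columns⇒alignment (r , r-inj) (c , _) rows⊆columns =
      Product.map id (λ Φ≗φ m → trans (cong c (Φ≗φ m)) (proj₂ (rows⊆columns m)))
        (injective⇒permutation φ-injective)
      where
      φ-injective : Injective _≡_ _≡_ (proj₁ ∘ rows⊆columns)
      φ-injective {m} {m′} eq =
        r-inj (trans (sym (proj₂ (rows⊆columns m)))
                (trans (cong c eq) (proj₂ (rows⊆columns m′))))

    -- Composing with Φ turns bijections I → I into bijections I → J with the
    -- same values and monomials.
    symSingular-principal⇒ : ∀ {s} (I J : IndexSet s n) (Φ : Permutation′ s) →
      (∀ m → proj₁ J (Φ ⟨$⟩ʳ m) ≡ proj₁ I m) →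
      SymTropicallySingular A I I → SymTropicallySingular A I J
    symSingular-principal⇒ I@(r , _) J@(c , _) Φ aligned =
      symSingular-transfer I I I J (_∘ₚ Φ) minimizer (λ π ρ p q eq →
        trans (sym (exponent-aligned π p q)) (trans eq (exponent-aligned ρ p q)))
      where
      exponent-aligned : ∀ π p q → exponent A I J (π ∘ₚ Φ) p q ≡ exponent A I I π p q
      exponent-aligned π = exponent-cong I J I (π ∘ₚ Φ) π (aligned ∘ (π ⟨$⟩ʳ_))

      minimizer : ∀ π → Minimizer A I I π → Minimizer A I J (π ∘ₚ Φ)
      minimizer π π-min τ = begin
        value A I J (π ∘ₚ Φ)          ≡⟨ value-cong I J I (π ∘ₚ Φ) π (aligned ∘ (π ⟨$⟩ʳ_)) ⟩
        value A I I π                 ≲⟨ π-min (τ ∘ₚ flip Φ) ⟩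
        value A I I (τ ∘ₚ flip Φ)     ≡⟨ value-cong I I J (τ ∘ₚ flip Φ) τ (λ k →
                                           trans (sym (aligned _)) (cong c (inverseʳ Φ))) ⟩
        value A I J τ                 ∎

    singular3⇒principal : (I J : IndexSet 3 n) →
      TropicallySingular A I J → ¬ SymTropicallySingular A I J →
      ¬ SymTropicallySingular A I I
    singular3⇒principal I J singular nonsingular =
      let Φ , aligned = rows⊆columns⇒alignment I J
                          (singular3⇒rows⊆columns I J singular nonsingular)
      in nonsingular ∘ symSingular-principal⇒ I J Φ aligned

    dropFirst : ∀ {s} → IndexSet (suc s) n → IndexSet s n
    dropFirst (r , r-inj) = r ∘ suc , λ eq → suc-injective (r-inj eq)

    dropAt : ∀ {s} → Fin (suc s) → IndexSet (suc s) n → IndexSet s n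
    dropAt j (c , c-inj) = c ∘ punchIn j , λ eq → punchIn-injective j _ _ (c-inj eq)

    -- Bijections of the minor extend by matching the first row to σ's column;
    -- this adds the same entry to every value and the same factor to every
    -- monomial.
    symSingular-minor⇒ : ∀ {s} (I J : IndexSet (suc s) n) (σ : Permutation′ (suc s)) →
      Minimizer A I J σ →
      SymTropicallySingular A (dropFirst I) (dropAt (σ ⟨$⟩ʳ zero) J) →
      SymTropicallySingular A I J
    symSingular-minor⇒ I@(r , _) J@(c , _) σ σ-min =
      symSingular-transfer I′ J′ I J extend minimizer monomial
      where
      j₀ = σ ⟨$⟩ʳ zero
      I′ = dropFirst I
      J′ = dropAt j₀ J

      extend : Permutation′ _ → Permutation′ _
      extend = insert zero j₀

      value-extend : ∀ π → value A I J (extend π) ≡ A (r zero) (c j₀) + value A I′ J′ π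
      value-extend π = cong (A (r zero) (c j₀) +_)
        (Σℝ-cong λ k → cong (A (r (suc k)) ∘ c) (insert-punchIn zero j₀ π k))

      minimizer : ∀ π → Minimizer A I′ J′ π → Minimizer A I J (extend π)
      minimizer π π-min τ = begin
        value A I J (extend π)             ≡⟨ value-extend π ⟩
        a₀ + value A I′ J′ π               ≲⟨ +-monoʳ-≤ a₀ (π-min σ′) ⟩
        a₀ + value A I′ J′ σ′              ≡⟨ value-extend σ′ ⟨
        value A I J (extend σ′)            ≡⟨ value-cong I J J (extend σ′) σ
                                                (cong c ∘ insert-remove zero σ) ⟩
        value A I J σ                      ≲⟨ σ-min τ ⟩
        value A I J τ                      ∎
        where
        a₀ = A (r zero) (c j₀)
        σ′ = remove zero σ

      factor : Permutation′ _ → Fin n → Fin n → Fin _ → Bool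
      factor π p q k = isFactor A I J (extend π) k p q

      exponent-tail : ∀ π p q → countℕ (factor π p q ∘ suc) ≡ exponent A I′ J′ π p q
      exponent-tail π p q = countℕ-cong λ k →
        cong (λ j → samePair (r (suc k)) (c j) p q) (insert-punchIn zero j₀ π k)

      monomial : ∀ π ρ p q → exponent A I J (extend π) p q ≡ exponent A I J (extend ρ) p q →
                 exponent A I′ J′ π p q ≡ exponent A I′ J′ ρ p q
      monomial π ρ p q eq = trans (sym (exponent-tail π p q))
        (trans (countℕ-tail-cancel (factor π p q) (factor ρ p q) refl eq) (exponent-tail ρ p q))

    rank2⇒principal3 : TropicalRankIs A 2 →
      ∀ s (I J : IndexSet (3 ℕ.+ s) n) → ¬ SymTropicallySingular A I J →
      ∃[ K ] ¬ SymTropicallySingular {n} {3} A K K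
    rank2⇒principal3 (_ , singular) zero I J nonsingular =
      I , singular3⇒principal I J (singular 3 (s≤s (s≤s (s≤s z≤n))) I J) nonsingular
    rank2⇒principal3 rank2@(_ , singular) (suc s) I J nonsingular
      with singular (4 ℕ.+ s) (s≤s (s≤s (s≤s z≤n))) I J
    ... | σ , _ , σ-min , _ =
      rank2⇒principal3 rank2 s (dropFirst I) (dropAt (σ ⟨$⟩ʳ zero) J)
        (nonsingular ∘ symSingular-minor⇒ I J σ σ-min)

open Submatrices using (rank2⇒principal3)

proposition3 : (R : RealNumbers) → let open Tropical R in
    ∀ {n : ℕ} (A : Matrix n) → Symmetric A → TropicalRankIs A 2 →
    (SymTropicalRank> A 2 ⇔ (∃[ I ] ¬ SymTropicallySingular {n} {3} A I I))
proposition3 R A _ rank2 = mk⇔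
  (λ { (suc (suc (suc s)) , s≤s (s≤s (s≤s _)) , I , J , nonsingular) →
         rank2⇒principal3 R A rank2 s I J nonsingular })
  (λ { (I , nonsingular) → 3 , s≤s (s≤s (s≤s z≤n)) , I , I , nonsingular })
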